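{- Let $G$ be a graph, let $e$ be an edge of $G$ with ends $u$ and $v$, and let $G'$ be an even subdivision of $G$ at $e$, i.e. $G'$ is obtained from $G$ by replacing $e$ by a $uv$-path $P_e$ of odd length at least three whose internal vertices are new vertices. Then $G'$ is cycle-nice if and only if $G$ is cycle-nice.
   Context: All graphs are connected and loopless but may have multiple edges; two parallel edges form a cycle of length two. A perfect matching is a set of independent edges covering all vertices. A subgraph $H$ of $G$ is nice if $G-V(H)$ has a perfect matching (the empty graph has the empty perfect matching). A graph $G$ is cycle-nice if for every even cycle $C$ of $G$, $G-V(C)$ has a perfect matching. -}

module Defs where

open import Data.Nat using (ℕ; zero; suc; _+_; _*_)
open import Data.Nat.Divisibility using (_∣_)
open import Data.Fin using (Fin; zero; suc; _↑ˡ_; _↑ʳ_; splitAt; _≟_)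
open import Data.Bool using (Bool; true)
open import Data.Maybe using (Maybe; just; nothing; fromMaybe)
import Data.Maybe as Maybe
open import Data.Product using (Σ; ∃; _×_; _,_; proj₁; proj₂)
open import Data.Sum using (_⊎_; inj₁; inj₂)
open import Relation.Nullary using (¬_; yes; no)
open import Relation.Binary.PropositionalEquality using (_≡_)
open import Function.Definitions using (Injective)

-- A finite multigraph with vertex set Fin n and edge set Fin m;
-- each edge has an (arbitrarily oriented) pair of ends.
record Graph (n m : ℕ) : Set where
  field
    ends : Fin m → Fin n × Fin n
open Graph public

module _ {n m : ℕ} (G : Graph n m) where

  Joins : Fin m → Fin n → Fin n → Set
  Joins f x y = ends G f ≡ (x , y) ⊎ ends G f ≡ (y , x)

  Incident : Fin m → Fin n → Set
  Incident f x = proj₁ (ends G f) ≡ x ⊎ proj₂ (ends G f) ≡ x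

  Loopless : Set
  Loopless = ∀ f → ¬ (proj₁ (ends G f) ≡ proj₂ (ends G f))

  data Reach : Fin n → Fin n → Set where
    here : ∀ {x} → Reach x x
    step : ∀ {x y z} (f : Fin m) → Joins f x y → Reach y z → Reach x z

  Connected : Set
  Connected = ∀ x y → Reach x y

nextFin : ∀ {r} → Fin (suc r) → Maybe (Fin (suc r))
nextFin {zero}  zero    = nothing
nextFin {suc r} zero    = just (suc zero)
nextFin {suc r} (suc i) = Maybe.map suc (nextFin i)

csuc : ∀ {r} → Fin (suc r) → Fin (suc r)
csuc i = fromMaybe zero (nextFin i)

module _ {n m : ℕ} (G : Graph n m) where

  -- A cycle of length (2 + len): distinct vertices vs 0 .. vs (len+1),
  -- distinct edges es i joining vs i and vs (i+1 mod length).
  -- (Length 2 = two distinct parallel edges.)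
  record Cycle : Set where
    field
      len   : ℕ
      vs    : Fin (suc (suc len)) → Fin n
      es    : Fin (suc (suc len)) → Fin m
      vs-inj : Injective _≡_ _≡_ vs
      es-inj : Injective _≡_ _≡_ es
      joins : ∀ i → Joins G (es i) (vs i) (vs (csuc i))

  open Cycle public

  cycleLength : Cycle → ℕ
  cycleLength C = suc (suc (len C))

  EvenCycle : Cycle → Set
  EvenCycle C = 2 ∣ cycleLength C

  OnCycle : Cycle → Fin n → Set
  OnCycle C x = ∃ λ i → vs C i ≡ x

  IsPerfectMatchingAvoiding : (Fin n → Set) → (Fin m → Bool) → Set
  IsPerfectMatchingAvoiding S M =
      (∀ f → M f ≡ true → ¬ S (proj₁ (ends G f)) × ¬ S (proj₂ (ends G f)))
    × (∀ x → ¬ S x → ∃ λ f → M f ≡ true × Incident G f x)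
    × (∀ f g x → M f ≡ true → M g ≡ true → Incident G f x → Incident G g x → f ≡ g)

  HasPerfectMatchingAvoiding : (Fin n → Set) → Set
  HasPerfectMatchingAvoiding S = Σ (Fin m → Bool) (IsPerfectMatchingAvoiding S)

  CycleNice : Set
  CycleNice = (C : Cycle) → EvenCycle C → HasPerfectMatchingAvoiding (OnCycle C)

-- Even subdivision of G at edge e with path of length 2t+3 (odd, ≥ 3).
-- New internal vertices w_0 .. w_{k-1} (k = 2t+2) are n ↑ʳ j.
-- Edge e is re-used as the edge u w_0 (where ends e = (u , v)); new edges
-- n-indexed j join w_j to w_{j+1}, and the last one joins w_{k-1} to v.
-- So P_e = u w_0 w_1 ... w_{k-1} v has k+1 = 2t+3 edges.
innerCount : ℕ → ℕ
innerCount t = suc (suc (2 * t))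

subdivide : ∀ {n m} → Graph n m → Fin m → (t : ℕ) →
            Graph (n + innerCount t) (m + innerCount t)
subdivide {n} {m} G e t = record { ends = E }
  where
  k = innerCount t
  u = proj₁ (ends G e)
  v = proj₂ (ends G e)
  old : Fin n → Fin (n + k)
  old x = x ↑ˡ k
  new : Fin k → Fin (n + k)
  new j = n ↑ʳ j
  E : Fin (m + k) → Fin (n + k) × Fin (n + k)
  E i with splitAt m i
  ... | inj₂ j = new j , fromMaybe (old v) (Maybe.map new (nextFin j))
  ... | inj₁ f with f ≟ e
  ...   | yes _ = old u , new zero
  ...   | no _  = old (proj₁ (ends G f)) , old (proj₂ (ends G f))

module Submission where

-- The new vertices have degree two, so a cycle of G′ meeting one of them
-- contains the whole path; hence the even cycles of G′ are
--   * the even cycles of G avoiding e, unchanged, and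
--   * the even cycles of G through e with e replaced by the path (k is even).
-- Perfect matchings of the complements correspond as follows.  If the cycle
-- contains the path, both complements are the same graph.  If the cycle avoids
-- e, a perfect matching M of G - V(C) extends to G′ - V(C) by matching the path
-- alternately, starting with its first edge iff e ∈ M; conversely a perfect
-- matching of G′ - V(C) alternates along the path, which has odd length, so it
-- contains the first path edge iff it contains the last, and restricts to G.

open import Defs
open import Data.Nat using (ℕ; zero; suc; _+_; _*_; _≤_; s≤s; z≤n)
open import Data.Nat.Divisibility using (_∣_; divides; ∣m∣n⇒∣m+n; ∣m+n∣m⇒∣n)
import Data.Nat.Properties as ℕP
open import Data.Fin using (Fin; zero; suc; _↑ˡ_; _↑ʳ_; splitAt; inject₁; fromℕ; toℕ; _≟_)
import Data.Fin.Properties as FinP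
open import Data.Fin.Induction using (<-weakInduction)
open import Data.Bool using (Bool; true; false; not; _xor_)
open import Data.Bool.Properties using (not-involutive; not-distribˡ-xor; not-¬; ¬-not)
open import Data.Maybe using (just; nothing; fromMaybe)
import Data.Maybe as Maybe
import Data.Maybe.Properties as MaybeP
open import Data.Product using (Σ; ∃; _×_; _,_; proj₁; proj₂)
open import Data.Sum using (_⊎_; inj₁; inj₂; [_,_]′)
import Data.Sum
open import Data.Empty using (⊥-elim)
open import Relation.Nullary using (¬_; yes; no)
open import Relation.Binary.PropositionalEquality using (_≡_; _≢_; refl; sym; trans; cong; cong₂; subst; setoid)
open Relation.Binary.PropositionalEquality.≡-Reasoning
open import Function using (_∘_)
open import Function.Bundles using (_⇔_; mk⇔; Equivalence)
open import Data.List using (List; []; _∷_; _++_; map; length; tabulate; [_]; lookup)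
import Data.List.Properties as ListP
open import Data.List.Relation.Unary.Any using (here; there)
import Data.List.Relation.Unary.Any as Any
import Data.List.Relation.Unary.Any.Properties as AnyP
open import Data.List.Relation.Unary.All using (_∷_)
import Data.List.Relation.Unary.All as All
open import Data.List.Relation.Unary.All.Properties.Core using (¬Any⇒All¬)
open import Data.List.Relation.Unary.AllPairs using (_∷_)
open import Data.List.Relation.Unary.Unique.Propositional using (Unique)
import Data.List.Relation.Unary.Unique.Propositional.Properties as UniqueP
open import Data.List.Membership.Propositional using (_∈_; _∉_)
import Data.List.Membership.Propositional.Properties as ∈P
open import Data.List.Relation.Binary.Permutation.Propositional
  using (_↭_; ↭-sym; ↭-trans; ↭-refl; ↭-reflexive; prep; ↭⇒↭ₛ)
import Data.List.Relation.Binary.Permutation.Propositional.Properties as ↭P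
import Data.List.Relation.Binary.Permutation.Setoid.Properties as ↭ₛP

uniqueHead : ∀ {A : Set} {x : A} {xs} → Unique (x ∷ xs) → x ∉ xs
uniqueHead = UniqueP.Unique[x∷xs]⇒x∉xs

uniqueTail : ∀ {A : Set} {x : A} {xs} → Unique (x ∷ xs) → Unique xs
uniqueTail (_ ∷ u) = u

unique-∷ : ∀ {A : Set} {x : A} {xs} → x ∉ xs → Unique xs → Unique (x ∷ xs)
unique-∷ {xs = xs} x∉xs u = ¬Any⇒All¬ xs x∉xs ∷ u

unique-resp-↭ : ∀ {A : Set} {xs ys : List A} → xs ↭ ys → Unique xs → Unique ys
unique-resp-↭ p = ↭ₛP.Unique-resp-↭ (setoid _) (↭⇒↭ₛ p)

unique-dropMiddle : ∀ {A : Set} {x : A} ys {zs} → Unique (x ∷ ys ++ zs) → Unique (x ∷ zs)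
unique-dropMiddle []       u = u
unique-dropMiddle (y ∷ ys) ((_ ∷ x∉) ∷ (_ ∷ u)) = unique-dropMiddle ys (x∉ ∷ u)

unique-++-disjoint : ∀ {A : Set} (xs : List A) {ys z} → Unique (xs ++ ys) → z ∈ xs → z ∉ ys
unique-++-disjoint (x ∷ xs) (x∉ ∷ _) (here refl) z∈ys = All.lookup x∉ (∈P.∈-++⁺ʳ xs z∈ys) refl
unique-++-disjoint (x ∷ xs) (_ ∷ u)  (there z∈xs) z∈ys = unique-++-disjoint xs u z∈xs z∈ys

lookup-injective : ∀ {A B : Set} (h : A → B) (xs : List A) → Unique (map h xs) →
                   ∀ i j → h (lookup xs i) ≡ h (lookup xs j) → i ≡ j
lookup-injective h (x ∷ xs) u zero    zero    eq = refl
lookup-injective h (x ∷ xs) u zero    (suc j) eq =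
  ⊥-elim (uniqueHead u (subst (_∈ map h xs) (sym eq) (∈P.∈-map⁺ h (∈P.∈-lookup j))))
lookup-injective h (x ∷ xs) u (suc i) zero    eq =
  ⊥-elim (uniqueHead u (subst (_∈ map h xs) eq (∈P.∈-map⁺ h (∈P.∈-lookup i))))
lookup-injective h (x ∷ xs) u (suc i) (suc j) eq = cong suc (lookup-injective h xs (uniqueTail u) i j eq)

module Interleave {X Y : Set} {r : ℕ} (old : X → Y) (new : Fin r → Y)
  (old-inj : ∀ {a b} → old a ≡ old b → a ≡ b) (new-inj : ∀ {i j} → new i ≡ new j → i ≡ j)
  (old≢new : ∀ {a j} → old a ≢ new j) where

  unique⁺ : ∀ {x₀ R} → Unique (x₀ ∷ R) → Unique (old x₀ ∷ tabulate new ++ map old R)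
  unique⁺ {x₀} {R} u =
    unique-∷ head∉ (UniqueP.++⁺ (UniqueP.tabulate⁺ new-inj) (UniqueP.map⁺ old-inj (uniqueTail u)) disjoint)
    where
    head∉ : old x₀ ∉ tabulate new ++ map old R
    head∉ mem with ∈P.∈-++⁻ (tabulate new) mem
    ... | inj₁ inNew = old≢new (proj₂ (∈P.∈-tabulate⁻ inNew))
    ... | inj₂ inOld with ∈P.∈-map⁻ old inOld
    ...   | y , y∈R , eq = uniqueHead u (subst (_∈ R) (sym (old-inj eq)) y∈R)
    disjoint : ∀ {z} → ¬ (z ∈ tabulate new × z ∈ map old R)
    disjoint (inNew , inOld) with ∈P.∈-tabulate⁻ inNew | ∈P.∈-map⁻ old inOld
    ... | j , refl | y , _ , eq = old≢new (sym eq)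

  unique⁻ : ∀ {x₀ R} → Unique (old x₀ ∷ tabulate new ++ map old R) → Unique (x₀ ∷ R)
  unique⁻ u = UniqueP.map⁻ (unique-dropMiddle (tabulate new) u)

nextOr : ∀ {r} {A : Set} → (Fin (suc r) → A) → A → Fin (suc r) → A
nextOr f z j = fromMaybe z (Maybe.map f (nextFin j))

prevOr : ∀ {r} {A : Set} → (Fin (suc r) → A) → A → Fin (suc r) → A
prevOr g l₀ zero    = l₀
prevOr g l₀ (suc i) = g (inject₁ i)

nextOr-suc : ∀ {r} {A : Set} (f : Fin (suc (suc r)) → A) z j →
             nextOr f z (suc j) ≡ nextOr (f ∘ suc) z j
nextOr-suc f z j = cong (fromMaybe z) (sym (MaybeP.map-∘ (nextFin j)))

fromMaybe-natural : ∀ {r} {A : Set} (h : Fin (suc r) → A) mb →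
                    h (fromMaybe zero mb) ≡ fromMaybe (h zero) (Maybe.map h mb)
fromMaybe-natural h nothing  = refl
fromMaybe-natural h (just _) = refl

csuc-nextOr : ∀ {r} {A : Set} (h : Fin (suc r) → A) j → h (csuc j) ≡ nextOr h (h zero) j
csuc-nextOr h j = fromMaybe-natural h (nextFin j)

nextFin-just : ∀ {r} (i j : Fin (suc r)) → nextFin i ≡ just j → ∃ λ i′ → j ≡ suc i′ × i ≡ inject₁ i′
nextFin-just {zero}  zero    j ()
nextFin-just {suc r} zero    .(suc zero) refl = zero , refl , refl
nextFin-just {suc r} (suc i) j eq with nextFin i in eq′
nextFin-just {suc r} (suc i) .(suc j′) refl | just j′ with nextFin-just i j′ eq′
... | i′ , refl , refl = suc i′ , refl , refl

nextFin-inject₁ : ∀ {r} (i : Fin r) → nextFin (inject₁ i) ≡ just (suc i)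
nextFin-inject₁ {suc zero}    zero    = refl
nextFin-inject₁ {suc (suc r)} zero    = refl
nextFin-inject₁ {suc r}       (suc i) rewrite nextFin-inject₁ i = refl

nextFin-nothing : ∀ {r} (i : Fin (suc r)) → nextFin i ≡ nothing → i ≡ fromℕ r
nextFin-nothing {zero}  zero    _ = refl
nextFin-nothing {suc r} zero    ()
nextFin-nothing {suc r} (suc i) eq with nextFin i in eq′
... | nothing = cong suc (nextFin-nothing i eq′)

nextFin-fromℕ : ∀ r → nextFin (fromℕ r) ≡ nothing
nextFin-fromℕ zero    = refl
nextFin-fromℕ (suc r) rewrite nextFin-fromℕ r = refl

inject₁≢suc : ∀ {r} (i : Fin r) → inject₁ i ≢ suc i
inject₁≢suc zero    ()
inject₁≢suc (suc i) eq = inject₁≢suc i (FinP.suc-injective eq)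

false≢true : false ≢ true
false≢true ()

isEven : ℕ → Bool
isEven zero    = true
isEven (suc r) = not (isEven r)

isEven-2* : ∀ t → isEven (2 * t) ≡ true
isEven-2* zero    = refl
isEven-2* (suc t) rewrite ℕP.+-suc t (t + 0) = trans (not-involutive _) (isEven-2* t)

-- Walks and list cycles in an arbitrary multigraph

module Walks {n m : ℕ} (G : Graph n m) where

  -- A step of a walk: a vertex together with the edge leaving it.
  Step : Set
  Step = Fin n × Fin m

  vertices : List Step → List (Fin n)
  vertices = map proj₁

  edges : List Step → List (Fin m)
  edges = map proj₂

  data Walk : Fin n → Fin n → List Step → Set where
    nil  : ∀ {x} → Walk x x []
    cons : ∀ {x y z f ps} → Joins G f x y → Walk y z ps → Walk x z ((x , f) ∷ ps)

  -- A cycle presented as the step list of a closed walk without repeated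
  -- vertices or edges.  Unlike Cycle, it can be rotated and reversed freely.
  record ListCycle (ps : List Step) : Set where
    field
      base            : Fin n
      closed          : Walk base base ps
      vertices-unique : Unique (vertices ps)
      edges-unique    : Unique (edges ps)
      nontrivial      : 2 ≤ length ps

  ListCycleNice : Set
  ListCycleNice = ∀ ps → ListCycle ps → 2 ∣ length ps →
                  HasPerfectMatchingAvoiding G (_∈ vertices ps)

  SameSupport : List Step → List Step → Set
  SameSupport ps qs = vertices ps ↭ vertices qs × edges ps ↭ edges qs

  sameSupport-trans : ∀ {ps qs rs} → SameSupport ps qs → SameSupport qs rs → SameSupport ps rs
  sameSupport-trans (v₁ , e₁) (v₂ , e₂) = ↭-trans v₁ v₂ , ↭-trans e₁ e₂

  sameSupport-length : ∀ {ps qs} → SameSupport ps qs → length ps ≡ length qs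
  sameSupport-length {ps} {qs} (_ , e↭) =
    trans (sym (ListP.length-map proj₂ ps)) (trans (↭P.↭-length e↭) (ListP.length-map proj₂ qs))

  listCycle-resp : ∀ {ps qs x} → SameSupport ps qs → ListCycle ps → Walk x x qs → ListCycle qs
  listCycle-resp s cy w = record
    { base = _ ; closed = w
    ; vertices-unique = unique-resp-↭ (proj₁ s) (ListCycle.vertices-unique cy)
    ; edges-unique    = unique-resp-↭ (proj₂ s) (ListCycle.edges-unique cy)
    ; nontrivial      = subst (2 ≤_) (sameSupport-length s) (ListCycle.nontrivial cy) }

  matching-cong : ∀ {S S' : Fin n → Set} → (∀ z → S' z → S z) → (∀ z → S z → S' z) →
                  HasPerfectMatchingAvoiding G S → HasPerfectMatchingAvoiding G S'
  matching-cong S'⊆S S⊆S' (M , avoids , covers , unique) =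
    M , (λ f Mf → (proj₁ (avoids f Mf) ∘ S'⊆S _) , (proj₂ (avoids f Mf) ∘ S'⊆S _)) ,
    (λ x x∉S' → covers x (x∉S' ∘ S⊆S' x)) , unique

  matching-sameSupport : ∀ {ps qs} → SameSupport ps qs →
                         HasPerfectMatchingAvoiding G (_∈ vertices qs) →
                         HasPerfectMatchingAvoiding G (_∈ vertices ps)
  matching-sameSupport (v↭ , _) =
    matching-cong (λ _ → ↭P.∈-resp-↭ v↭) (λ _ → ↭P.∈-resp-↭ (↭-sym v↭))

  start : List Step → Fin n → Fin n
  start []            z = z
  start ((x , _) ∷ _) _ = x

  start-walk : ∀ {x z ps} → Walk x z ps → start ps z ≡ x
  start-walk nil        = refl
  start-walk (cons _ _) = refl

  _++ʷ_ : ∀ {x y z ps qs} → Walk x y ps → Walk y z qs → Walk x z (ps ++ qs)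
  nil      ++ʷ q = q
  cons j p ++ʷ q = cons j (p ++ʷ q)

  splitWalk : ∀ {x z} ps {qs} → Walk x z (ps ++ qs) → Σ (Fin n) λ y → Walk x y ps × Walk y z qs
  splitWalk []       p = _ , nil , p
  splitWalk (_ ∷ ps) (cons j p) with splitWalk ps p
  ... | y , p₁ , p₂ = y , cons j p₁ , p₂

  joins-sym : ∀ {f x y} → Joins G f x y → Joins G f y x
  joins-sym (inj₁ p) = inj₂ p
  joins-sym (inj₂ p) = inj₁ p

  reverseSteps : List Step → Fin n → List Step
  reverseSteps []             z = []
  reverseSteps ((_ , f) ∷ ps) z = reverseSteps ps z ++ [ (start ps z , f) ]

  reverseWalk : ∀ {x z ps} → Walk x z ps → Walk z x (reverseSteps ps z)
  reverseWalk nil = nil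
  reverseWalk (cons j p) rewrite start-walk p = reverseWalk p ++ʷ cons (joins-sym j) nil

  successors : List Step → Fin n → List (Fin n)
  successors []       z = []
  successors (_ ∷ ps) z = start ps z ∷ successors ps z

  start∷successors : ∀ ps z → start ps z ∷ successors ps z ≡ vertices ps ++ [ z ]
  start∷successors []            z = refl
  start∷successors ((x , _) ∷ ps) z = cong (x ∷_) (start∷successors ps z)

  snoc↭cons : ∀ {A : Set} (xs : List A) y → xs ++ [ y ] ↭ y ∷ xs
  snoc↭cons xs y = ↭-sym (↭P.∷↭∷ʳ y xs)

  edges-reverse : ∀ ps z → edges (reverseSteps ps z) ↭ edges ps
  edges-reverse []             z = ↭-refl
  edges-reverse ((_ , f) ∷ ps) z =
    ↭-trans (↭-reflexive (ListP.map-++ proj₂ (reverseSteps ps z) _))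
      (↭-trans (↭P.++⁺ʳ _ (edges-reverse ps z)) (snoc↭cons (edges ps) f))

  vertices-reverse : ∀ ps z → vertices (reverseSteps ps z) ↭ successors ps z
  vertices-reverse []       z = ↭-refl
  vertices-reverse (_ ∷ ps) z =
    ↭-trans (↭-reflexive (ListP.map-++ proj₁ (reverseSteps ps z) _))
      (↭-trans (↭P.++⁺ʳ _ (vertices-reverse ps z)) (snoc↭cons (successors ps z) (start ps z)))

  reverseClosed : ∀ {x y f rest} → Joins G f x y → Walk y x rest →
                  Walk y y ((y , f) ∷ reverseSteps rest x) ×
                  SameSupport ((x , f) ∷ rest) ((y , f) ∷ reverseSteps rest x)
  reverseClosed {x} {y} {f} {rest} j p =
    cons (joins-sym j) (reverseWalk p) ,
    ↭-sym (↭-trans (prep y (vertices-reverse rest x))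
      (↭-trans (↭-reflexive (trans (cong (_∷ successors rest x) (sym (start-walk p)))
                                   (start∷successors rest x)))
        (snoc↭cons (vertices rest) x))) ,
    prep f (↭-sym (edges-reverse rest x))

  rotate : ∀ {x} A B → Walk x x (A ++ B) → Σ (Fin n) λ y → Walk y y (B ++ A) × SameSupport (A ++ B) (B ++ A)
  rotate A B p with splitWalk A p
  ... | y , p₁ , p₂ = y , p₂ ++ʷ p₁ , swap proj₁ , swap proj₂
    where
    swap : ∀ {C : Set} (h : Step → C) → map h (A ++ B) ↭ map h (B ++ A)
    swap h = ↭-trans (↭-reflexive (ListP.map-++ h A B))
               (↭-trans (↭P.++-comm (map h A) (map h B)) (↭-reflexive (sym (ListP.map-++ h B A))))

  rotateTo : ∀ {x ps p} → Walk x x ps → p ∈ ps →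
             Σ (List Step) λ rest → Walk (proj₁ p) (proj₁ p) (p ∷ rest) × SameSupport ps (p ∷ rest)
  rotateTo p p∈ps with ∈P.∈-∃++ p∈ps
  ... | A , B , refl with rotate A (_ ∷ B) p
  ... | _ , cons j q , s = B ++ A , cons j q , s

  rotateToEdge : ∀ {ps f} → ListCycle ps → f ∈ edges ps →
                 Σ (Fin n) λ a → Σ (List Step) λ rest → Walk a a ((a , f) ∷ rest) × SameSupport ps ((a , f) ∷ rest)
  rotateToEdge cy f∈ with ∈P.∈-map⁻ proj₂ f∈
  ... | (a , _) , p∈ , refl = a , rotateTo (ListCycle.closed cy) p∈

  rotateToVertex : ∀ {ps z} → ListCycle ps → z ∈ vertices ps →
                   Σ (Fin m) λ f → Σ (List Step) λ rest → Walk z z ((z , f) ∷ rest) × SameSupport ps ((z , f) ∷ rest)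
  rotateToVertex cy z∈ with ∈P.∈-map⁻ proj₁ z∈
  ... | (_ , f) , p∈ , refl = f , rotateTo (ListCycle.closed cy) p∈

  tabulateWalk : ∀ r (w : Fin (suc r) → Fin n) (g : Fin (suc r) → Fin m) z →
                 (∀ j → Joins G (g j) (w j) (nextOr w z j)) →
                 Walk (w zero) z (tabulate (λ j → w j , g j))
  tabulateWalk zero    w g z joins = cons (joins zero) nil
  tabulateWalk (suc r) w g z joins =
    cons (joins zero) (tabulateWalk r (w ∘ suc) (g ∘ suc) z
      (λ j → subst (Joins G _ _) (nextOr-suc w z j) (joins (suc j))))

  walk-lookup : ∀ {a b} p ps → Walk a b (p ∷ ps) → ∀ i →
                Joins G (proj₂ (lookup (p ∷ ps) i)) (proj₁ (lookup (p ∷ ps) i))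
                        (nextOr (proj₁ ∘ lookup (p ∷ ps)) b i)
  walk-lookup p []        (cons j nil) zero = j
  walk-lookup p (p′ ∷ ps) (cons j q)   zero rewrite start-walk q = j
  walk-lookup p (p′ ∷ ps) (cons j q)   (suc i) =
    subst (Joins G _ _) (sym (nextOr-suc (proj₁ ∘ lookup (p ∷ p′ ∷ ps)) _ i)) (walk-lookup p′ ps q i)

  record Represents (C : Cycle G) (ps : List Step) : Set where
    field
      same-length : length ps ≡ cycleLength G C
      onCycle⇒∈   : ∀ z → OnCycle G C z → z ∈ vertices ps
      ∈⇒onCycle   : ∀ z → z ∈ vertices ps → OnCycle G C z

  cycle→list : (C : Cycle G) → Σ (List Step) λ ps → ListCycle ps × Represents C ps
  cycle→list C = ps , cy , record
    { same-length = ListP.length-tabulate stepAt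
    ; onCycle⇒∈ = λ { z (i , refl) → subst (z ∈_) (sym vertices-ps) (∈P.∈-tabulate⁺ {f = vs C} i) }
    ; ∈⇒onCycle = λ z z∈ → let (i , eq) = ∈P.∈-tabulate⁻ {f = vs C} (subst (z ∈_) vertices-ps z∈)
                           in i , sym eq }
    where
    stepAt : Fin (cycleLength G C) → Step
    stepAt i = vs C i , es C i
    ps : List Step
    ps = tabulate stepAt
    vertices-ps : vertices ps ≡ tabulate (vs C)
    vertices-ps = ListP.map-tabulate stepAt proj₁
    cy : ListCycle ps
    cy = record
      { base = vs C zero
      ; closed = tabulateWalk (suc (len C)) (vs C) (es C) (vs C zero)
                   (λ j → subst (Joins G _ _) (csuc-nextOr (vs C) j) (joins C j))
      ; vertices-unique = subst Unique (sym vertices-ps) (UniqueP.tabulate⁺ (vs-inj C))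
      ; edges-unique = subst Unique (sym (ListP.map-tabulate stepAt proj₂)) (UniqueP.tabulate⁺ (es-inj C))
      ; nontrivial = subst (2 ≤_) (sym (ListP.length-tabulate stepAt)) (s≤s (s≤s z≤n)) }

  list→cycle : ∀ {ps} → ListCycle ps → Σ (Cycle G) λ C → Represents C ps
  list→cycle {[]}          record { nontrivial = () }
  list→cycle {_ ∷ []}      record { nontrivial = s≤s () }
  list→cycle {p₁ ∷ p₂ ∷ rest} cy = C , record
    { same-length = refl
    ; onCycle⇒∈ = λ { z (i , refl) → ∈P.∈-map⁺ proj₁ (∈P.∈-lookup i) }
    ; ∈⇒onCycle = λ z z∈ → let z∈′ = AnyP.map⁻ z∈ in Any.index z∈′ , sym (AnyP.lookup-index z∈′) }
    where
    ps : List Step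
    ps = p₁ ∷ p₂ ∷ rest
    C : Cycle G
    C = record
      { len = length rest
      ; vs = λ i → proj₁ (lookup ps i)
      ; es = λ i → proj₂ (lookup ps i)
      ; vs-inj = λ {i} {j} → lookup-injective proj₁ ps (ListCycle.vertices-unique cy) i j
      ; es-inj = λ {i} {j} → lookup-injective proj₂ ps (ListCycle.edges-unique cy) i j
      ; joins = λ i → subst (Joins G _ _)
          (trans (cong (λ b → nextOr (proj₁ ∘ lookup ps) b i) (sym (start-walk (ListCycle.closed cy))))
                 (sym (csuc-nextOr (proj₁ ∘ lookup ps) i)))
          (walk-lookup p₁ (p₂ ∷ rest) (ListCycle.closed cy) i) }

  cycleNice⇔listCycleNice : CycleNice G ⇔ ListCycleNice
  cycleNice⇔listCycleNice = mk⇔ to from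
    where
    to : CycleNice G → ListCycleNice
    to nice ps cy even with list→cycle cy
    ... | C , r = matching-cong (Represents.∈⇒onCycle r) (Represents.onCycle⇒∈ r)
                    (nice C (subst (2 ∣_) (Represents.same-length r) even))
    from : ListCycleNice → CycleNice G
    from nice C even with cycle→list C
    ... | ps , cy , r = matching-cong (Represents.onCycle⇒∈ r) (Represents.∈⇒onCycle r)
                          (nice ps cy (subst (2 ∣_) (sym (Represents.same-length r)) even))

  joins-incident : ∀ {h a b x} → Joins G h a b → Incident G h x → x ≡ a ⊎ x ≡ b
  joins-incident (inj₁ eq) (inj₁ p) = inj₁ (trans (sym p) (cong proj₁ eq))
  joins-incident (inj₁ eq) (inj₂ p) = inj₂ (trans (sym p) (cong proj₂ eq))
  joins-incident (inj₂ eq) (inj₁ p) = inj₂ (trans (sym p) (cong proj₁ eq))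
  joins-incident (inj₂ eq) (inj₂ p) = inj₁ (trans (sym p) (cong proj₂ eq))

  joins-incidentˡ : ∀ {h a b} → Joins G h a b → Incident G h a
  joins-incidentˡ (inj₁ eq) = inj₁ (cong proj₁ eq)
  joins-incidentˡ (inj₂ eq) = inj₂ (cong proj₂ eq)

  joins-incidentʳ : ∀ {h a b} → Joins G h a b → Incident G h b
  joins-incidentʳ j = joins-incidentˡ (joins-sym j)

  joins-functional : ∀ {h a x y} → Joins G h a x → Joins G h a y → x ≡ y
  joins-functional (inj₁ e₁) (inj₁ e₂) = trans (sym (cong proj₂ e₁)) (cong proj₂ e₂)
  joins-functional (inj₁ e₁) (inj₂ e₂) =
    trans (trans (sym (cong proj₂ e₁)) (cong proj₂ e₂)) (trans (sym (cong proj₁ e₁)) (cong proj₁ e₂))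
  joins-functional (inj₂ e₁) (inj₁ e₂) =
    trans (trans (sym (cong proj₁ e₁)) (cong proj₁ e₂)) (trans (sym (cong proj₂ e₁)) (cong proj₂ e₂))
  joins-functional (inj₂ e₁) (inj₂ e₂) = trans (sym (cong proj₁ e₁)) (cong proj₁ e₂)

  start-in : ∀ {y z ps} → Walk y z ps → y ∈ vertices ps ⊎ y ≡ z
  start-in nil        = inj₂ refl
  start-in (cons _ _) = inj₁ (here refl)

  ends-in-walk : ∀ {y z ps h x} → Walk y z ps → h ∈ edges ps → Incident G h x → x ∈ vertices ps ⊎ x ≡ z
  ends-in-walk (cons j q) (here refl) inc with joins-incident j inc
  ... | inj₁ refl = inj₁ (here refl)
  ... | inj₂ refl = Data.Sum.map₁ there (start-in q)
  ends-in-walk (cons j q) (there h∈) inc = Data.Sum.map₁ there (ends-in-walk q h∈ inc)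

  ends-in-closed : ∀ {x ps h y} → Walk x x ps → h ∈ edges ps → Incident G h y → y ∈ vertices ps
  ends-in-closed w@(cons _ _) h∈ inc with ends-in-walk w h∈ inc
  ... | inj₁ y∈    = y∈
  ... | inj₂ refl = here refl

  last-edge : ∀ {y z p rest} → Walk y z (p ∷ rest) → Σ (Fin m) λ h → h ∈ edges (p ∷ rest) × Incident G h z
  last-edge (cons j nil)          = _ , here refl , joins-incidentʳ j
  last-edge (cons _ (cons j′ q)) with last-edge (cons j′ q)
  ... | h , h∈ , inc = h , there h∈ , inc

  two-cycle-edges : ∀ {ps z} → ListCycle ps → z ∈ vertices ps →
    Σ (Fin m) λ h₁ → Σ (Fin m) λ h₂ → h₁ ≢ h₂ × h₁ ∈ edges ps × h₂ ∈ edges ps ×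
                                       Incident G h₁ z × Incident G h₂ z
  two-cycle-edges cy z∈ with rotateToVertex cy z∈
  ... | h₁ , rest , w , s with rest | w | s | listCycle-resp s cy w
  ... | []        | _        | _ | record { nontrivial = s≤s () }
  ... | p ∷ rest′ | cons j q | s | cy′ with last-edge q
  ...   | h₂ , h₂∈ , inc₂ =
    h₁ , h₂ , (λ { refl → uniqueHead (ListCycle.edges-unique cy′) h₂∈ }) ,
    ↭P.∈-resp-↭ (↭-sym (proj₂ s)) (here refl) , ↭P.∈-resp-↭ (↭-sym (proj₂ s)) (there h₂∈) ,
    joins-incidentˡ j , inc₂

  -- Chains of degree-two vertices

  -- Vertices w 0 … w r of degree two: w j meets only the edge before it
  -- (the entry edge for j = 0) and the edge g j, which leads to w (j+1),
  -- or to the exit vertex after the last one.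
  record Chain (r : ℕ) : Set where
    field
      w          : Fin (suc r) → Fin n
      g          : Fin (suc r) → Fin m
      entry      : Fin m
      exit       : Fin n
      forward    : ∀ j → Joins G (g j) (w j) (nextOr w exit j)
      degree-two : ∀ j h → Incident G h (w j) → h ≡ prevOr g entry j ⊎ h ≡ g j

    steps : List Step
    steps = tabulate (λ j → w j , g j)

  chain-tail : ∀ {r} → Chain (suc r) → Chain r
  chain-tail c = record
    { w = w ∘ suc ; g = g ∘ suc ; entry = g zero ; exit = exit
    ; forward = λ j → subst (Joins G _ _) (nextOr-suc w exit j) (forward (suc j))
    ; degree-two = λ { zero h → degree-two (suc zero) h ; (suc i) h → degree-two (suc (suc i)) h } }
    where open Chain c

  chain-traversal : ∀ {r} (c : Chain r) {z ps} → (∀ j → z ≢ Chain.w c j) →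
    Walk (Chain.w c zero) z ps → Chain.entry c ∉ edges ps → Unique (edges ps) →
    Σ (List Step) λ rest → ps ≡ Chain.steps c ++ rest × Walk (Chain.exit c) z rest
  chain-traversal c z∉ nil _ _ = ⊥-elim (z∉ zero refl)
  chain-traversal c z∉ (cons {f = h} j q) entry∉ u with Chain.degree-two c zero h (joins-incidentˡ j)
  ... | inj₁ refl = ⊥-elim (entry∉ (here refl))
  ... | inj₂ refl with joins-functional j (Chain.forward c zero)
  chain-traversal {zero} c z∉ (cons {ps = ps} j q) _ _ | inj₂ refl | refl = ps , refl , q
  chain-traversal {suc r} c z∉ (cons j q) _ u | inj₂ refl | refl
    with chain-traversal (chain-tail c) (z∉ ∘ suc) q (uniqueHead u) (uniqueTail u)
  ... | rest , refl , q′ = rest , refl , q′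

  cycle-uses-previous : ∀ {r} (c : Chain r) {ps} → ListCycle ps → ∀ j →
    Chain.w c j ∈ vertices ps → prevOr (Chain.g c) (Chain.entry c) j ∈ edges ps
  cycle-uses-previous c cy j w∈ with two-cycle-edges cy w∈
  ... | h₁ , h₂ , h₁≢h₂ , h₁∈ , h₂∈ , inc₁ , inc₂
    with Chain.degree-two c j h₁ inc₁ | Chain.degree-two c j h₂ inc₂
  ... | inj₁ refl | _         = h₁∈
  ... | inj₂ _    | inj₁ refl = h₂∈
  ... | inj₂ refl | inj₂ refl = ⊥-elim (h₁≢h₂ refl)

  cycle-uses-entry : ∀ {r} (c : Chain r) {ps} → ListCycle ps → ∀ j →
    Chain.w c j ∈ vertices ps → Chain.entry c ∈ edges ps
  cycle-uses-entry {r} c {ps} cy = <-weakInduction P (cycle-uses-previous c cy zero) back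
    where
    open Chain c
    P : Fin (suc r) → Set
    P j = w j ∈ vertices ps → entry ∈ edges ps
    back : ∀ i → P (inject₁ i) → P (suc i)
    back i ih w∈ = ih (ends-in-closed (ListCycle.closed cy) (cycle-uses-previous c cy (suc i) w∈)
                                      (joins-incidentˡ (forward (inject₁ i))))

  base-on-cycle : ∀ {ps} (cy : ListCycle ps) → ListCycle.base cy ∈ vertices ps
  base-on-cycle record { closed = cons _ _ } = here refl

  orient : ∀ {f x y a rest} → ends G f ≡ (x , y) → Walk a a ((a , f) ∷ rest) →
           Σ (List Step) λ rest′ → Walk y x rest′ × SameSupport ((a , f) ∷ rest) ((x , f) ∷ rest′)
  orient ends≡ (cons (inj₁ eq) q) with trans (sym ends≡) eq
  ... | refl = _ , q , ↭-refl , ↭-refl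
  orient ends≡ (cons (inj₂ eq) q) with trans (sym ends≡) eq
  ... | refl = _ , reverseWalk q , proj₂ (reverseClosed (inj₂ eq) q)

  startAtEdge : ∀ {ps f x y} → ends G f ≡ (x , y) → ListCycle ps → f ∈ edges ps →
    Σ (List Step) λ rest → Walk y x rest × SameSupport ps ((x , f) ∷ rest) × ListCycle ((x , f) ∷ rest)
  startAtEdge ends≡ cy f∈ with rotateToEdge cy f∈
  ... | _ , _ , w , s with orient ends≡ w
  ... | rest , q , s′ = rest , q , sameSupport-trans s s′ , listCycle-resp (sameSupport-trans s s′) cy (cons (inj₁ ends≡) q)

  walk-nonempty : ∀ {a b R} → Walk a b R → a ≢ b → 1 ≤ length R
  walk-nonempty nil        a≢b = ⊥-elim (a≢b refl)
  walk-nonempty (cons _ _) _   = s≤s z≤n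

module _ {n m : ℕ} (G : Graph n m) where

  EdgeAvoids : (Fin n → Set) → Fin m → Set
  EdgeAvoids S f = ¬ S (proj₁ (ends G f)) × ¬ S (proj₂ (ends G f))

  Covers : (Fin m → Bool) → Fin n → Set
  Covers M x = ∃ λ f → M f ≡ true × Incident G f x

  UniqueAt : (Fin m → Bool) → Fin n → Set
  UniqueAt M x = ∀ f g → M f ≡ true → M g ≡ true → Incident G f x → Incident G g x → f ≡ g

  perfectMatching : ∀ {S} M → (∀ f → M f ≡ true → EdgeAvoids S f) → (∀ x → ¬ S x → Covers M x) →
                    (∀ x → UniqueAt M x) → HasPerfectMatchingAvoiding G S
  perfectMatching M avoid cover uniq = M , avoid , cover , λ f g x → uniq x f g

  avoids-via : ∀ {S f a b} → ends G f ≡ (a , b) → ¬ S a → ¬ S b → EdgeAvoids S f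
  avoids-via eq ¬Sa ¬Sb rewrite eq = ¬Sa , ¬Sb

  avoids-ends : ∀ {S f a b} → ends G f ≡ (a , b) → EdgeAvoids S f → ¬ S a × ¬ S b
  avoids-ends eq avoid rewrite eq = avoid

-- The even subdivision G′ of G at e

module Subdivision {n m : ℕ} (G : Graph n m) (e : Fin m) (t : ℕ) where

  k : ℕ
  k = innerCount t

  G′ : Graph (n + k) (m + k)
  G′ = subdivide G e t

  module W  = Walks G
  module W′ = Walks G′

  u v : Fin n
  u = proj₁ (ends G e)
  v = proj₂ (ends G e)

  old : Fin n → Fin (n + k)
  old x = x ↑ˡ k

  new : Fin k → Fin (n + k)
  new j = n ↑ʳ j

  oldE : Fin m → Fin (m + k)
  oldE f = f ↑ˡ k

  newE : Fin k → Fin (m + k)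
  newE j = m ↑ʳ j

  last : Fin k
  last = fromℕ (suc (2 * t))

  prev : Fin k → Fin (m + k)
  prev = prevOr newE (oldE e)

  old-injective : ∀ {x y} → old x ≡ old y → x ≡ y
  old-injective = FinP.↑ˡ-injective k _ _

  new-injective : ∀ {i j} → new i ≡ new j → i ≡ j
  new-injective = FinP.↑ʳ-injective n _ _

  oldE-injective : ∀ {f g} → oldE f ≡ oldE g → f ≡ g
  oldE-injective = FinP.↑ˡ-injective k _ _

  newE-injective : ∀ {i j} → newE i ≡ newE j → i ≡ j
  newE-injective = FinP.↑ʳ-injective m _ _

  old≢new : ∀ {x j} → old x ≢ new j
  old≢new {x} {j} eq with trans (sym (FinP.splitAt-↑ˡ n x k)) (trans (cong (splitAt n) eq) (FinP.splitAt-↑ʳ n k j))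
  ... | ()

  oldE≢newE : ∀ {f j} → oldE f ≢ newE j
  oldE≢newE {f} {j} eq with trans (sym (FinP.splitAt-↑ˡ m f k)) (trans (cong (splitAt m) eq) (FinP.splitAt-↑ʳ m k j))
  ... | ()

  data EdgeView : Fin (m + k) → Set where
    is-old : ∀ f → EdgeView (oldE f)
    is-new : ∀ j → EdgeView (newE j)

  edgeView : ∀ h → EdgeView h
  edgeView h with splitAt m h in eq
  ... | inj₁ f = subst EdgeView (FinP.splitAt⁻¹-↑ˡ eq) (is-old f)
  ... | inj₂ j = subst EdgeView (FinP.splitAt⁻¹-↑ʳ eq) (is-new j)

  data VertexView : Fin (n + k) → Set where
    is-old : ∀ x → VertexView (old x)
    is-new : ∀ j → VertexView (new j)

  vertexView : ∀ z → VertexView z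
  vertexView z with splitAt n z in eq
  ... | inj₁ x = subst VertexView (FinP.splitAt⁻¹-↑ˡ eq) (is-old x)
  ... | inj₂ j = subst VertexView (FinP.splitAt⁻¹-↑ʳ eq) (is-new j)

  ends-new : ∀ j → ends G′ (newE j) ≡ (new j , nextOr new (old v) j)
  ends-new j rewrite FinP.splitAt-↑ʳ m k j = refl

  ends-e : ends G′ (oldE e) ≡ (old u , new zero)
  ends-e rewrite FinP.splitAt-↑ˡ m e k with e ≟ e
  ... | yes _  = refl
  ... | no e≢e = ⊥-elim (e≢e refl)

  ends-old : ∀ f → f ≢ e → ends G′ (oldE f) ≡ (old (proj₁ (ends G f)) , old (proj₂ (ends G f)))
  ends-old f f≢e rewrite FinP.splitAt-↑ˡ m f k with f ≟ e
  ... | yes f≡e = ⊥-elim (f≢e f≡e)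
  ... | no _    = refl

  next-last : nextOr new (old v) last ≡ old v
  next-last = cong (λ mb → fromMaybe (old v) (Maybe.map new mb)) (nextFin-fromℕ (suc (2 * t)))

  ends-last : ends G′ (newE last) ≡ (new last , old v)
  ends-last = trans (ends-new last) (cong (new last ,_) next-last)

  next-new-or-last : ∀ j → (Σ (Fin k) λ j′ → nextOr new (old v) j ≡ new j′) ⊎ j ≡ last
  next-new-or-last j with nextFin j in eq
  ... | just j′ = inj₁ (j′ , refl)
  ... | nothing = inj₂ (nextFin-nothing j eq)

  ends-incident : ∀ {h a b x} → ends G′ h ≡ (a , b) → Incident G′ h x → x ≡ a ⊎ x ≡ b
  ends-incident eq = W′.joins-incident (inj₁ eq)

  incident-new : ∀ j h → Incident G′ h (new j) → h ≡ prev j ⊎ h ≡ newE j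
  incident-new j h inc with edgeView h
  ... | is-old f with f ≟ e
  ...   | yes refl with ends-incident ends-e inc
  ...     | inj₁ eq = ⊥-elim (old≢new (sym eq))
  ...     | inj₂ eq with new-injective eq
  ...       | refl = inj₁ refl
  incident-new j h inc | is-old f | no f≢e with ends-incident (ends-old f f≢e) inc
  ...     | inj₁ eq = ⊥-elim (old≢new (sym eq))
  ...     | inj₂ eq = ⊥-elim (old≢new (sym eq))
  incident-new j h inc | is-new i with ends-incident (ends-new i) inc
  ... | inj₁ eq with new-injective eq
  ...   | refl = inj₂ refl
  incident-new j h inc | is-new i | inj₂ eq with nextFin i in eq′
  ... | nothing = ⊥-elim (old≢new (sym eq))
  ... | just j′ with new-injective eq | nextFin-just i j′ eq′
  ...   | refl | i′ , refl , refl = inj₁ refl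

  prev-incident : ∀ j → Incident G′ (prev j) (new j)
  prev-incident zero    = inj₂ (cong proj₂ ends-e)
  prev-incident (suc i) = inj₂ (trans (cong proj₂ (ends-new (inject₁ i)))
                                      (cong (λ mb → fromMaybe (old v) (Maybe.map new mb)) (nextFin-inject₁ i)))

  next-incident : ∀ j → Incident G′ (newE j) (new j)
  next-incident j = inj₁ (cong proj₁ (ends-new j))

  prev≢next : ∀ j → prev j ≢ newE j
  prev≢next zero    eq = oldE≢newE eq
  prev≢next (suc i) eq = inject₁≢suc i (newE-injective eq)

  path : W′.Chain (suc (2 * t))
  path = record
    { w = new ; g = newE ; entry = oldE e ; exit = old v
    ; forward = λ j → inj₁ (ends-new j) ; degree-two = incident-new }

  data OldIncidence (x : Fin n) : Fin (m + k) → Set where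
    via-old   : ∀ f → f ≢ e → Incident G f x → OldIncidence x (oldE f)
    via-first : x ≡ u → OldIncidence x (oldE e)
    via-last  : x ≡ v → OldIncidence x (newE last)

  origin : ∀ {x h} → OldIncidence x h → Fin m
  origin (via-old f _ _) = f
  origin (via-first _)   = e
  origin (via-last _)    = e

  origin-incident : ∀ {x h} (o : OldIncidence x h) → Incident G (origin o) x
  origin-incident (via-old _ _ inc) = inc
  origin-incident (via-first refl)  = inj₁ refl
  origin-incident (via-last refl)   = inj₂ refl

  old-incidence : ∀ x h → Incident G′ h (old x) → OldIncidence x h
  old-incidence x h inc with edgeView h
  ... | is-old f with f ≟ e
  ...   | yes refl with ends-incident ends-e inc
  ...     | inj₁ eq = via-first (old-injective eq)
  ...     | inj₂ eq = ⊥-elim (old≢new eq)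
  old-incidence x h inc | is-old f | no f≢e with ends-incident (ends-old f f≢e) inc
  ...     | inj₁ eq = via-old f f≢e (inj₁ (sym (old-injective eq)))
  ...     | inj₂ eq = via-old f f≢e (inj₂ (sym (old-injective eq)))
  old-incidence x h inc | is-new i with ends-incident (ends-new i) inc
  ... | inj₁ eq = ⊥-elim (old≢new eq)
  ... | inj₂ eq with next-new-or-last i
  ...   | inj₁ (_ , eq′) = ⊥-elim (old≢new (trans eq eq′))
  ...   | inj₂ refl = via-last (old-injective (trans eq next-last))

  incident-old : ∀ {x h} → OldIncidence x h → Incident G′ h (old x)
  incident-old (via-old f f≢e (inj₁ p)) = inj₁ (trans (cong proj₁ (ends-old f f≢e)) (cong old p))
  incident-old (via-old f f≢e (inj₂ p)) = inj₂ (trans (cong proj₂ (ends-old f f≢e)) (cong old p))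
  incident-old (via-first refl)         = inj₁ (cong proj₁ ends-e)
  incident-old (via-last refl)          = inj₂ (cong proj₂ ends-last)

  copy : ∀ {f x} → Incident G f x → Σ (Fin (m + k)) λ h → Σ (OldIncidence x h) λ o → origin o ≡ f
  copy {f} inc with f ≟ e
  ... | no f≢e = oldE f , via-old f f≢e inc , refl
  copy (inj₁ p) | yes refl = oldE e , via-first (sym p) , refl
  copy (inj₂ p) | yes refl = newE last , via-last (sym p) , refl

  origin-functional : ∀ {x h₁ h₂} (o₁ : OldIncidence x h₁) (o₂ : OldIncidence x h₂) →
                      h₁ ≡ h₂ → origin o₁ ≡ origin o₂
  origin-functional (via-old _ _ _) (via-old _ _ _) eq = oldE-injective eq
  origin-functional (via-old _ _ _) (via-first _)   eq = oldE-injective eq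
  origin-functional (via-old _ _ _) (via-last _)    eq = ⊥-elim (oldE≢newE eq)
  origin-functional (via-first _)   (via-old _ _ _) eq = oldE-injective eq
  origin-functional (via-last _)    (via-old _ _ _) eq = ⊥-elim (oldE≢newE (sym eq))
  origin-functional (via-first _)   (via-first _)   _  = refl
  origin-functional (via-first _)   (via-last _)    _  = refl
  origin-functional (via-last _)    (via-first _)   _  = refl
  origin-functional (via-last _)    (via-last _)    _  = refl

  -- Since e is not a loop, u and v differ, and the origin determines the edge.
  origin-injective : Loopless G → ∀ {x h₁ h₂} (o₁ : OldIncidence x h₁) (o₂ : OldIncidence x h₂) →
                     origin o₁ ≡ origin o₂ → h₁ ≡ h₂
  origin-injective _  (via-old _ _ _)   (via-old _ _ _)   eq = cong oldE eq
  origin-injective _  (via-old _ f≢e _) (via-first _)     eq = ⊥-elim (f≢e eq)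
  origin-injective _  (via-old _ f≢e _) (via-last _)      eq = ⊥-elim (f≢e eq)
  origin-injective _  (via-first _)     (via-old _ g≢e _) eq = ⊥-elim (g≢e (sym eq))
  origin-injective _  (via-last _)      (via-old _ g≢e _) eq = ⊥-elim (g≢e (sym eq))
  origin-injective _  (via-first _)     (via-first _)     _  = refl
  origin-injective _  (via-last _)      (via-last _)      _  = refl
  origin-injective ll (via-first x≡u)   (via-last x≡v)    _  = ⊥-elim (ll e (trans (sym x≡u) x≡v))
  origin-injective ll (via-last x≡v)    (via-first x≡u)   _  = ⊥-elim (ll e (trans (sym x≡u) x≡v))

  record Agree (S : Fin n → Set) (S′ : Fin (n + k) → Set) : Set where
    field
      old⇒ : ∀ x → S′ (old x) → S x
      ⇒old : ∀ x → S x → S′ (old x)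
  open Agree

  record Compatible (M : Fin m → Bool) (M′ : Fin (m + k) → Bool) : Set where
    field
      on-old  : ∀ f → M′ (oldE f) ≡ M f
      on-last : M′ (newE last) ≡ M e
  open Compatible

  compatible-origin : ∀ {M M′} → Compatible M M′ → ∀ {x h} (o : OldIncidence x h) → M′ h ≡ M (origin o)
  compatible-origin c (via-old f _ _) = on-old c f
  compatible-origin c (via-first _)   = on-old c e
  compatible-origin c (via-last _)    = on-last c

  covers-old⁺ : ∀ {M M′ x} → Compatible M M′ → Covers G M x → Covers G′ M′ (old x)
  covers-old⁺ c (f , Mf , inc) with copy inc
  ... | h , o , refl = h , trans (compatible-origin c o) Mf , incident-old o

  covers-old⁻ : ∀ {M M′ x} → Compatible M M′ → Covers G′ M′ (old x) → Covers G M x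
  covers-old⁻ {x = x} c (h , M′h , inc) = origin o , trans (sym (compatible-origin c o)) M′h , origin-incident o
    where
    o : OldIncidence x h
    o = old-incidence x h inc

  unique-old⁺ : ∀ {M M′ x} → Loopless G → Compatible M M′ → UniqueAt G M x → UniqueAt G′ M′ (old x)
  unique-old⁺ {x = x} ll c uniq h₁ h₂ M′h₁ M′h₂ inc₁ inc₂ =
    origin-injective ll o₁ o₂
      (uniq _ _ (trans (sym (compatible-origin c o₁)) M′h₁) (trans (sym (compatible-origin c o₂)) M′h₂)
                (origin-incident o₁) (origin-incident o₂))
    where
    o₁ : OldIncidence x h₁
    o₁ = old-incidence x h₁ inc₁
    o₂ : OldIncidence x h₂
    o₂ = old-incidence x h₂ inc₂

  unique-old⁻ : ∀ {M M′ x} → Compatible M M′ → UniqueAt G′ M′ (old x) → UniqueAt G M x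
  unique-old⁻ c uniq′ _ _ Mf Mg inc₁ inc₂ with copy inc₁ | copy inc₂
  ... | h₁ , o₁ , refl | h₂ , o₂ , refl =
    origin-functional o₁ o₂
      (uniq′ h₁ h₂ (trans (compatible-origin c o₁) Mf) (trans (compatible-origin c o₂) Mg)
                   (incident-old o₁) (incident-old o₂))

  avoids-old⁺ : ∀ {S S′ f} → Agree S S′ → f ≢ e → EdgeAvoids G S f → EdgeAvoids G′ S′ (oldE f)
  avoids-old⁺ {S′ = S′} agree f≢e (¬S₁ , ¬S₂) = avoids-via G′ {S = S′} (ends-old _ f≢e) (¬S₁ ∘ old⇒ agree _) (¬S₂ ∘ old⇒ agree _)

  avoids-old⁻ : ∀ {S S′ f} → Agree S S′ → f ≢ e → EdgeAvoids G′ S′ (oldE f) → EdgeAvoids G S f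
  avoids-old⁻ {S′ = S′} agree f≢e avoid′ with avoids-ends G′ {S = S′} (ends-old _ f≢e) avoid′
  ... | ¬S′₁ , ¬S′₂ = ¬S′₁ ∘ ⇒old agree _ , ¬S′₂ ∘ ⇒old agree _

  Alternating : (Fin (m + k) → Bool) → Set
  Alternating M′ = ∀ j → M′ (newE j) ≡ not (M′ (prev j))

  PathValues : (Fin (m + k) → Bool) → Set
  PathValues M′ = ∀ j → M′ (newE j) ≡ isEven (toℕ j) xor M′ (oldE e)

  pathValues-step : ∀ b (i : Fin (suc (2 * t))) → isEven (toℕ (suc i)) xor b ≡ not (isEven (toℕ (inject₁ i)) xor b)
  pathValues-step b i = begin
    not (isEven (toℕ i)) xor b            ≡⟨ sym (not-distribˡ-xor (isEven (toℕ i)) b) ⟩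
    not (isEven (toℕ i) xor b)            ≡⟨ cong (λ r → not (isEven r xor b)) (sym (FinP.toℕ-inject₁ i)) ⟩
    not (isEven (toℕ (inject₁ i)) xor b)  ∎

  values⇒alternating : ∀ M′ → PathValues M′ → Alternating M′
  values⇒alternating M′ vals zero    = vals zero
  values⇒alternating M′ vals (suc i) =
    trans (vals (suc i)) (trans (pathValues-step (M′ (oldE e)) i) (cong not (sym (vals (inject₁ i)))))

  alternating⇒values : ∀ M′ → Alternating M′ → PathValues M′
  alternating⇒values M′ alt = <-weakInduction (λ j → M′ (newE j) ≡ isEven (toℕ j) xor M′ (oldE e))
    (alt zero)
    (λ i ih → trans (alt (suc i)) (trans (cong not ih) (sym (pathValues-step (M′ (oldE e)) i))))

  -- The path has an odd number of edges, so an alternating matching uses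
  -- its last edge exactly when it uses its first edge e.
  alternating-last : ∀ M′ → Alternating M′ → M′ (newE last) ≡ M′ (oldE e)
  alternating-last M′ alt =
    trans (alternating⇒values M′ alt last) (cong (_xor M′ (oldE e)) isEven-last)
    where
    isEven-last : isEven (toℕ last) ≡ false
    isEven-last = trans (cong isEven (FinP.toℕ-fromℕ (suc (2 * t)))) (cong not (isEven-2* t))

  perfect⇒alternating : ∀ M′ → (∀ j → Covers G′ M′ (new j)) → (∀ j → UniqueAt G′ M′ (new j)) → Alternating M′
  perfect⇒alternating M′ cover uniq j with M′ (prev j) in p | M′ (newE j) in q
  ... | true  | true  = ⊥-elim (prev≢next j (uniq j _ _ p q (prev-incident j) (next-incident j)))
  ... | true  | false = refl
  ... | false | true  = refl
  ... | false | false with cover j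
  ...   | h , M′h , inc with incident-new j h inc
  ...     | inj₁ refl = ⊥-elim (false≢true (trans (sym p) M′h))
  ...     | inj₂ refl = ⊥-elim (false≢true (trans (sym q) M′h))

  covers-new : ∀ M′ → Alternating M′ → ∀ j → Covers G′ M′ (new j)
  covers-new M′ alt j with M′ (prev j) in p
  ... | true  = prev j , p , prev-incident j
  ... | false = newE j , trans (alt j) (cong not p) , next-incident j

  unique-new : ∀ M′ j → ¬ (M′ (prev j) ≡ true × M′ (newE j) ≡ true) → UniqueAt G′ M′ (new j)
  unique-new M′ j ¬both h₁ h₂ M′h₁ M′h₂ inc₁ inc₂ with incident-new j h₁ inc₁ | incident-new j h₂ inc₂
  ... | inj₁ refl | inj₁ refl = refl
  ... | inj₂ refl | inj₂ refl = refl
  ... | inj₁ refl | inj₂ refl = ⊥-elim (¬both (M′h₁ , M′h₂))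
  ... | inj₂ refl | inj₁ refl = ⊥-elim (¬both (M′h₂ , M′h₁))

  alternating⇒¬both : ∀ M′ → Alternating M′ → ∀ j → ¬ (M′ (prev j) ≡ true × M′ (newE j) ≡ true)
  alternating⇒¬both M′ alt j (p , q) = not-¬ refl (trans (sym q) (trans (alt j) (cong not p)))

  -- Transfer of perfect matchings

  combine : (Fin m → Bool) → (Fin k → Bool) → Fin (m + k) → Bool
  combine M N h = [ M , N ]′ (splitAt m h)

  combine-old : ∀ M N f → combine M N (oldE f) ≡ M f
  combine-old M N f rewrite FinP.splitAt-↑ˡ m f k = refl

  combine-new : ∀ M N j → combine M N (newE j) ≡ N j
  combine-new M N j rewrite FinP.splitAt-↑ʳ m k j = refl

  extend-through : ∀ {S S′} → Loopless G → Agree S S′ → (∀ j → S′ (new j)) → S u →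
                   HasPerfectMatchingAvoiding G S → HasPerfectMatchingAvoiding G′ S′
  extend-through {S} {S′} ll agree new∈S′ Su (M , avoid , cover , uniq) =
    perfectMatching G′ M′ avoid′ cover′ uniq′
    where
    M′ : Fin (m + k) → Bool
    M′ = combine M (λ _ → false)
    e∉M : M e ≡ false
    e∉M = ¬-not (λ Me → proj₁ (avoid e Me) Su)
    compatible : Compatible M M′
    compatible = record { on-old = combine-old M _ ; on-last = trans (combine-new M _ last) (sym e∉M) }
    avoid′ : ∀ h → M′ h ≡ true → EdgeAvoids G′ S′ h
    avoid′ h M′h with edgeView h
    ... | is-new j = ⊥-elim (false≢true (trans (sym (combine-new M _ j)) M′h))
    ... | is-old f = avoids-old⁺ agree f≢e (avoid f Mf)
      where
      Mf : M f ≡ true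
      Mf = trans (sym (combine-old M _ f)) M′h
      f≢e : f ≢ e
      f≢e refl = false≢true (trans (sym e∉M) Mf)
    cover′ : ∀ z → ¬ S′ z → Covers G′ M′ z
    cover′ z ¬S′z with vertexView z
    ... | is-old x = covers-old⁺ compatible (cover x (¬S′z ∘ ⇒old agree x))
    ... | is-new j = ⊥-elim (¬S′z (new∈S′ j))
    uniq′ : ∀ z → UniqueAt G′ M′ z
    uniq′ z with vertexView z
    ... | is-old x = unique-old⁺ ll compatible (λ f g → uniq f g x)
    ... | is-new j = unique-new M′ j (λ (_ , q) → false≢true (trans (sym (combine-new M _ j)) q))

  restrict-through : ∀ {S S′} → Agree S S′ → (∀ j → S′ (new j)) → S u →
                     HasPerfectMatchingAvoiding G′ S′ → HasPerfectMatchingAvoiding G S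
  restrict-through {S} {S′} agree new∈S′ Su (M′ , avoid′ , cover′ , uniq′) =
    perfectMatching G M avoid cover uniq
    where
    M : Fin m → Bool
    M f = M′ (oldE f)
    first∉M′ : M′ (oldE e) ≡ false
    first∉M′ = ¬-not (λ p → proj₁ (avoids-ends G′ {S = S′} ends-e (avoid′ _ p)) (⇒old agree u Su))
    last∉M′ : M′ (newE last) ≡ false
    last∉M′ = ¬-not (λ p → proj₁ (avoids-ends G′ {S = S′} ends-last (avoid′ _ p)) (new∈S′ last))
    compatible : Compatible M M′
    compatible = record { on-old = λ _ → refl ; on-last = trans last∉M′ (sym first∉M′) }
    avoid : ∀ f → M f ≡ true → EdgeAvoids G S f
    avoid f Mf = avoids-old⁻ agree f≢e (avoid′ _ Mf)
      where
      f≢e : f ≢ e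
      f≢e refl = false≢true (trans (sym first∉M′) Mf)
    cover : ∀ x → ¬ S x → Covers G M x
    cover x ¬Sx = covers-old⁻ compatible (cover′ (old x) (¬Sx ∘ old⇒ agree x))
    uniq : ∀ x → UniqueAt G M x
    uniq x = unique-old⁻ compatible (λ f g → uniq′ f g (old x))

  -- When no vertex of the path is deleted, a perfect matching M of G - S
  -- extends to G′ - S′ by matching the path alternately, starting with the
  -- first edge exactly when e ∈ M.
  extend-avoiding : ∀ {S S′} → Loopless G → Agree S S′ → (∀ j → ¬ S′ (new j)) →
                    HasPerfectMatchingAvoiding G S → HasPerfectMatchingAvoiding G′ S′
  extend-avoiding {S} {S′} ll agree new∉S′ (M , avoid , cover , uniq) =
    perfectMatching G′ M′ avoid′ cover′ uniq′
    where
    N : Fin k → Bool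
    N j = isEven (toℕ j) xor M e
    M′ : Fin (m + k) → Bool
    M′ = combine M N
    alternating : Alternating M′
    alternating = values⇒alternating M′ λ j →
      trans (combine-new M N j) (cong (isEven (toℕ j) xor_) (sym (combine-old M N e)))
    compatible : Compatible M M′
    compatible = record { on-old = combine-old M _
                        ; on-last = trans (alternating-last M′ alternating) (combine-old M _ e) }
    avoid′ : ∀ h → M′ h ≡ true → EdgeAvoids G′ S′ h
    avoid′ h M′h with edgeView h
    ... | is-old f with f ≟ e
    ...   | no f≢e = avoids-old⁺ agree f≢e (avoid f (trans (sym (combine-old M _ f)) M′h))
    ...   | yes refl = avoids-via G′ {S = S′} ends-e (proj₁ (avoid e (trans (sym (combine-old M _ e)) M′h)) ∘ old⇒ agree u)
                                            (new∉S′ zero)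
    avoid′ h M′h | is-new j with next-new-or-last j
    ... | inj₁ (j′ , next≡) = avoids-via G′ {S = S′} (trans (ends-new j) (cong (new j ,_) next≡)) (new∉S′ j) (new∉S′ j′)
    ... | inj₂ refl = avoids-via G′ {S = S′} ends-last (new∉S′ last)
                        (proj₂ (avoid e (trans (sym (on-last compatible)) M′h)) ∘ old⇒ agree v)
    cover′ : ∀ z → ¬ S′ z → Covers G′ M′ z
    cover′ z ¬S′z with vertexView z
    ... | is-old x = covers-old⁺ compatible (cover x (¬S′z ∘ ⇒old agree x))
    ... | is-new j = covers-new M′ alternating j
    uniq′ : ∀ z → UniqueAt G′ M′ z
    uniq′ z with vertexView z
    ... | is-old x = unique-old⁺ ll compatible (λ f g → uniq f g x)
    ... | is-new j = unique-new M′ j (alternating⇒¬both M′ alternating j)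

  restrict-avoiding : ∀ {S S′} → Agree S S′ → (∀ j → ¬ S′ (new j)) →
                      HasPerfectMatchingAvoiding G′ S′ → HasPerfectMatchingAvoiding G S
  restrict-avoiding {S} {S′} agree new∉S′ (M′ , avoid′ , cover′ , uniq′) =
    perfectMatching G M avoid cover uniq
    where
    M : Fin m → Bool
    M f = M′ (oldE f)
    alternating : Alternating M′
    alternating = perfect⇒alternating M′ (λ j → cover′ (new j) (new∉S′ j)) (λ j f g → uniq′ f g (new j))
    compatible : Compatible M M′
    compatible = record { on-old = λ _ → refl ; on-last = alternating-last M′ alternating }
    avoid : ∀ f → M f ≡ true → EdgeAvoids G S f
    avoid f Mf with f ≟ e
    ... | no f≢e = avoids-old⁻ agree f≢e (avoid′ _ Mf)
    ... | yes refl = proj₁ (avoids-ends G′ {S = S′} ends-e (avoid′ _ Mf)) ∘ ⇒old agree u ,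
                     proj₂ (avoids-ends G′ {S = S′} ends-last (avoid′ _ (trans (on-last compatible) Mf))) ∘ ⇒old agree v
    cover : ∀ x → ¬ S x → Covers G M x
    cover x ¬Sx = covers-old⁻ compatible (cover′ (old x) (¬Sx ∘ old⇒ agree x))
    uniq : ∀ x → UniqueAt G M x
    uniq x = unique-old⁻ compatible (λ f g → uniq′ f g (old x))

  -- Cycles of G avoiding e versus cycles of G′ avoiding the path

  oldStep : W.Step → W′.Step
  oldStep (a , f) = old a , oldE f

  vertices-oldSteps : ∀ R → W′.vertices (map oldStep R) ≡ map old (W.vertices R)
  vertices-oldSteps R = trans (sym (ListP.map-∘ R)) (ListP.map-∘ R)

  edges-oldSteps : ∀ R → W′.edges (map oldStep R) ≡ map oldE (W.edges R)
  edges-oldSteps R = trans (sym (ListP.map-∘ R)) (ListP.map-∘ R)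

  old∈map-old : ∀ {x xs} → old x ∈ map old xs → x ∈ xs
  old∈map-old {x} x∈ with ∈P.∈-map⁻ old x∈
  ... | y , y∈ , eq = subst (_∈ _) (sym (old-injective eq)) y∈

  new∉map-old : ∀ {j xs} → new j ∉ map old xs
  new∉map-old j∈ with ∈P.∈-map⁻ old j∈
  ... | _ , _ , eq = old≢new (sym eq)

  agree-oldSteps : ∀ R → Agree (_∈ W.vertices R) (_∈ W′.vertices (map oldStep R))
  agree-oldSteps R = record
    { old⇒ = λ x x∈ → old∈map-old (subst (old x ∈_) (vertices-oldSteps R) x∈)
    ; ⇒old = λ x x∈ → subst (old x ∈_) (sym (vertices-oldSteps R)) (∈P.∈-map⁺ old x∈) }

  new∉oldSteps : ∀ R j → new j ∉ W′.vertices (map oldStep R)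
  new∉oldSteps R j j∈ = new∉map-old (subst (new j ∈_) (vertices-oldSteps R) j∈)

  oldWalk : ∀ {x y R} → W.Walk x y R → e ∉ W.edges R → W′.Walk (old x) (old y) (map oldStep R)
  oldWalk W.nil _ = W′.nil
  oldWalk (W.cons {f = f} j q) e∉ with f ≟ e
  ... | yes refl = ⊥-elim (e∉ (here refl))
  ... | no f≢e   = W′.cons (copy-joins j) (oldWalk q (e∉ ∘ there))
    where
    copy-joins : ∀ {a b} → Joins G f a b → Joins G′ (oldE f) (old a) (old b)
    copy-joins (inj₁ eq) = inj₁ (trans (ends-old f f≢e) (cong (λ p → old (proj₁ p) , old (proj₂ p)) eq))
    copy-joins (inj₂ eq) = inj₂ (trans (ends-old f f≢e) (cong (λ p → old (proj₁ p) , old (proj₂ p)) eq))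

  oldCycle : ∀ {R} → W.ListCycle R → e ∉ W.edges R → W′.ListCycle (map oldStep R)
  oldCycle {R} cy e∉ = record
    { base = old (W.ListCycle.base cy)
    ; closed = oldWalk (W.ListCycle.closed cy) e∉
    ; vertices-unique = subst Unique (sym (vertices-oldSteps R)) (UniqueP.map⁺ old-injective (W.ListCycle.vertices-unique cy))
    ; edges-unique = subst Unique (sym (edges-oldSteps R)) (UniqueP.map⁺ oldE-injective (W.ListCycle.edges-unique cy))
    ; nontrivial = subst (2 ≤_) (sym (ListP.length-map oldStep R)) (W.ListCycle.nontrivial cy) }

  project-joins : ∀ {x h b} → Joins G′ h (old x) b → h ≢ oldE e → (∀ j → b ≢ new j) →
                  Σ (Fin m) λ f → Σ (Fin n) λ y → h ≡ oldE f × b ≡ old y × Joins G f x y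
  project-joins {h = h} j h≢e b≢new with edgeView h
  ... | is-new i with j
  ...   | inj₁ eq = ⊥-elim (old≢new (sym (cong proj₁ (trans (sym (ends-new i)) eq))))
  ...   | inj₂ eq = ⊥-elim (b≢new i (sym (cong proj₁ (trans (sym (ends-new i)) eq))))
  project-joins j h≢e b≢new | is-old f with f ≟ e
  ... | yes refl = ⊥-elim (h≢e refl)
  ... | no f≢e with j
  ...   | inj₁ eq = let eq′ = trans (sym (ends-old f f≢e)) eq in
                    f , _ , refl , sym (cong proj₂ eq′) , inj₁ (cong₂ _,_ (old-injective (cong proj₁ eq′)) refl)
  ...   | inj₂ eq = let eq′ = trans (sym (ends-old f f≢e)) eq in
                    f , _ , refl , sym (cong proj₁ eq′) , inj₂ (cong₂ _,_ refl (old-injective (cong proj₂ eq′)))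

  start∉new : ∀ {c b y R′} → W′.Walk c b R′ → b ≡ old y → (∀ j → new j ∉ W′.vertices R′) → ∀ j → c ≢ new j
  start∉new q b≡ new∉ j refl with W′.start-in q
  ... | inj₁ c∈ = new∉ j c∈
  ... | inj₂ c≡b = old≢new (sym (trans c≡b b≡))

  projectWalk : ∀ {a b x y R′} → W′.Walk a b R′ → a ≡ old x → b ≡ old y →
                (∀ j → new j ∉ W′.vertices R′) → oldE e ∉ W′.edges R′ →
                Σ (List W.Step) λ R → W.Walk x y R × R′ ≡ map oldStep R
  projectWalk W′.nil refl b≡ _ _ with old-injective b≡
  ... | refl = [] , W.nil , refl
  projectWalk (W′.cons j q) refl b≡ new∉ e∉
    with project-joins j (λ h≡ → e∉ (here (sym h≡))) (start∉new q b≡ (λ i → new∉ i ∘ there))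
  ... | f , _ , refl , refl , jG with projectWalk q refl b≡ (λ i → new∉ i ∘ there) (e∉ ∘ there)
  ...   | R , w , refl = (_ , f) ∷ R , W.cons jG w , refl

  old-or-new : ∀ z → (Σ (Fin n) λ x → z ≡ old x) ⊎ (Σ (Fin k) λ j → z ≡ new j)
  old-or-new z with vertexView z
  ... | is-old x = inj₁ (x , refl)
  ... | is-new j = inj₂ (j , refl)

  projectCycle : ∀ {R′} → W′.ListCycle R′ → oldE e ∉ W′.edges R′ → (∀ j → new j ∉ W′.vertices R′) →
                 Σ (List W.Step) λ R → W.ListCycle R × R′ ≡ map oldStep R
  projectCycle cy e∉ new∉ with old-or-new (W′.ListCycle.base cy)
  ... | inj₂ (j , base≡) = ⊥-elim (new∉ j (subst (_∈ _) base≡ (W′.base-on-cycle cy)))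
  ... | inj₁ (x , base≡) with projectWalk (W′.ListCycle.closed cy) base≡ base≡ new∉ e∉
  ...   | R , w , refl = R , cyG , refl
    where
    cyG : W.ListCycle R
    cyG = record
      { base = x ; closed = w
      ; vertices-unique = UniqueP.map⁻ (subst Unique (vertices-oldSteps R) (W′.ListCycle.vertices-unique cy))
      ; edges-unique = UniqueP.map⁻ (subst Unique (edges-oldSteps R) (W′.ListCycle.edges-unique cy))
      ; nontrivial = subst (2 ≤_) (ListP.length-map oldStep R) (W′.ListCycle.nontrivial cy) }

  -- Cycles of G through e versus cycles of G′ through the path

  pathStep : Fin k → W′.Step
  pathStep j = new j , newE j

  pathSteps : List W′.Step
  pathSteps = tabulate pathStep

  throughPath : List W.Step → List W′.Step
  throughPath R = (old u , oldE e) ∷ pathSteps ++ map oldStep R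

  vertices-throughPath : ∀ R → W′.vertices (throughPath R) ≡ old u ∷ tabulate new ++ map old (W.vertices R)
  vertices-throughPath R = cong (old u ∷_)
    (trans (ListP.map-++ proj₁ pathSteps _) (cong₂ _++_ (ListP.map-tabulate pathStep proj₁) (vertices-oldSteps R)))

  edges-throughPath : ∀ R → W′.edges (throughPath R) ≡ oldE e ∷ tabulate newE ++ map oldE (W.edges R)
  edges-throughPath R = cong (oldE e ∷_)
    (trans (ListP.map-++ proj₂ pathSteps _) (cong₂ _++_ (ListP.map-tabulate pathStep proj₂) (edges-oldSteps R)))

  length-throughPath : ∀ R → length (throughPath R) ≡ k + length ((u , e) ∷ R)
  length-throughPath R = trans
    (cong suc (trans (ListP.length-++ pathSteps) (cong₂ _+_ (ListP.length-tabulate pathStep) (ListP.length-map oldStep R))))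
    (sym (ℕP.+-suc k (length R)))

  agree-throughPath : ∀ R → Agree (_∈ W.vertices ((u , e) ∷ R)) (_∈ W′.vertices (throughPath R))
  agree-throughPath R = record { old⇒ = old⇒′ ; ⇒old = ⇒old′ }
    where
    old⇒′ : ∀ x → old x ∈ W′.vertices (throughPath R) → x ∈ W.vertices ((u , e) ∷ R)
    old⇒′ x x∈ with subst (old x ∈_) (vertices-throughPath R) x∈
    ... | here eq = here (old-injective eq)
    ... | there x∈′ with ∈P.∈-++⁻ (tabulate new) x∈′
    ...   | inj₁ x∈new = ⊥-elim (old≢new (proj₂ (∈P.∈-tabulate⁻ {f = new} x∈new)))
    ...   | inj₂ x∈old = there (old∈map-old x∈old)
    ⇒old′ : ∀ x → x ∈ W.vertices ((u , e) ∷ R) → old x ∈ W′.vertices (throughPath R)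
    ⇒old′ x (here refl) = here refl
    ⇒old′ x (there x∈) = subst (old x ∈_) (sym (vertices-throughPath R))
                           (there (∈P.∈-++⁺ʳ (tabulate new) (∈P.∈-map⁺ old x∈)))

  new∈throughPath : ∀ R j → new j ∈ W′.vertices (throughPath R)
  new∈throughPath R j = subst (new j ∈_) (sym (vertices-throughPath R))
                          (there (∈P.∈-++⁺ˡ (∈P.∈-tabulate⁺ {f = new} j)))

  module OldNew  = Interleave old new old-injective new-injective old≢new
  module OldNewE = Interleave oldE newE oldE-injective newE-injective oldE≢newE

  throughCycle : ∀ {R} → W.ListCycle ((u , e) ∷ R) → W.Walk v u R → W′.ListCycle (throughPath R)
  throughCycle {R} cy w = record
    { base = old u
    ; closed = W′.cons (inj₁ ends-e)
                 (W′.tabulateWalk _ new newE (old v) (W′.Chain.forward path)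
                   W′.++ʷ oldWalk w (uniqueHead (W.ListCycle.edges-unique cy)))
    ; vertices-unique = subst Unique (sym (vertices-throughPath R)) (OldNew.unique⁺ (W.ListCycle.vertices-unique cy))
    ; edges-unique = subst Unique (sym (edges-throughPath R)) (OldNewE.unique⁺ (W.ListCycle.edges-unique cy))
    ; nontrivial = s≤s (s≤s z≤n) }

  -- Conversely; here u ≠ v ensures that the cycle of G has length at least two.
  unthroughCycle : Loopless G → ∀ {R} → W′.ListCycle (throughPath R) → W.Walk v u R → W.ListCycle ((u , e) ∷ R)
  unthroughCycle ll {R} cy w = record
    { base = u
    ; closed = W.cons (inj₁ refl) w
    ; vertices-unique = OldNew.unique⁻ (subst Unique (vertices-throughPath R) (W′.ListCycle.vertices-unique cy))
    ; edges-unique = OldNewE.unique⁻ (subst Unique (edges-throughPath R) (W′.ListCycle.edges-unique cy))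
    ; nontrivial = s≤s (W.walk-nonempty w (λ v≡u → ll e (sym v≡u))) }

  rest-avoids-path : ∀ {rest} → W′.ListCycle ((old u , oldE e) ∷ pathSteps ++ rest) →
                     (∀ j → new j ∉ W′.vertices rest) × oldE e ∉ W′.edges rest
  rest-avoids-path {rest} cy = new∉ , e∉
    where
    new∉ : ∀ j → new j ∉ W′.vertices rest
    new∉ j = unique-++-disjoint (W′.vertices pathSteps)
               (subst Unique (ListP.map-++ proj₁ pathSteps rest) (uniqueTail (W′.ListCycle.vertices-unique cy)))
               (subst (new j ∈_) (sym (ListP.map-tabulate pathStep proj₁)) (∈P.∈-tabulate⁺ {f = new} j))
    e∉ : oldE e ∉ W′.edges rest
    e∉ e∈ = uniqueHead (W′.ListCycle.edges-unique cy)
              (subst (oldE e ∈_) (sym (ListP.map-++ proj₂ pathSteps rest)) (∈P.∈-++⁺ʳ (W′.edges pathSteps) e∈))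

  2∣k : 2 ∣ k
  2∣k = divides (suc t) (cong (2 +_) (ℕP.*-comm 2 t))

  even-throughPath⁺ : ∀ R → 2 ∣ length ((u , e) ∷ R) → 2 ∣ length (throughPath R)
  even-throughPath⁺ R even = subst (2 ∣_) (sym (length-throughPath R)) (∣m∣n⇒∣m+n 2∣k even)

  even-throughPath⁻ : ∀ R → 2 ∣ length (throughPath R) → 2 ∣ length ((u , e) ∷ R)
  even-throughPath⁻ R even = ∣m+n∣m⇒∣n (subst (2 ∣_) (length-throughPath R) even) 2∣k

  nice′⇒nice : W′.ListCycleNice → W.ListCycleNice
  nice′⇒nice nice′ ps cy even with Any.any? (e ≟_) (W.edges ps)
  ... | no e∉ = restrict-avoiding (agree-oldSteps ps) (new∉oldSteps ps)
                  (nice′ _ (oldCycle cy e∉) (subst (2 ∣_) (sym (ListP.length-map oldStep ps)) even))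
  ... | yes e∈ with W.startAtEdge refl cy e∈
  ...   | R , w , same , cy′ = W.matching-sameSupport same
          (restrict-through (agree-throughPath R) (new∈throughPath R) (here refl)
            (nice′ _ (throughCycle cy′ w) (even-throughPath⁺ R (subst (2 ∣_) (W.sameSupport-length same) even))))

  nice⇒nice′ : Loopless G → W.ListCycleNice → W′.ListCycleNice
  nice⇒nice′ ll nice ps′ cy even with Any.any? (oldE e ≟_) (W′.edges ps′)
  ... | no e∉ with projectCycle cy e∉ (λ j j∈ → e∉ (W′.cycle-uses-entry path cy j j∈))
  ...   | R , cyG , refl = extend-avoiding ll (agree-oldSteps R) (new∉oldSteps R)
                             (nice R cyG (subst (2 ∣_) (ListP.length-map oldStep R) even))
  nice⇒nice′ ll nice ps′ cy even | yes e∈ with W′.startAtEdge ends-e cy e∈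
  ... | R′ , w , same , cy′ with W′.chain-traversal path (λ j → old≢new) w
                                   (uniqueHead (W′.ListCycle.edges-unique cy′))
                                   (uniqueTail (W′.ListCycle.edges-unique cy′))
  ...   | rest , refl , w-rest with rest-avoids-path cy′
  ...     | new∉ , e∉ with projectWalk w-rest refl refl new∉ e∉
  ...       | R , wG , refl = W′.matching-sameSupport same
              (extend-through ll (agree-throughPath R) (new∈throughPath R) (here refl)
                (nice _ (unthroughCycle ll cy′ wG)
                  (even-throughPath⁻ R (subst (2 ∣_) (W′.sameSupport-length same) even))))

lemma2p5 : ∀ {n m} (G : Graph n m) → Connected G → Loopless G →
           (e : Fin m) (t : ℕ) →
           CycleNice (subdivide G e t) ⇔ CycleNice G
lemma2p5 G _ loopless e t = mk⇔
  (λ nice′ → from (W.cycleNice⇔listCycleNice) (nice′⇒nice (to W′.cycleNice⇔listCycleNice nice′)))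
  (λ nice  → from W′.cycleNice⇔listCycleNice (nice⇒nice′ loopless (to W.cycleNice⇔listCycleNice nice)))
  where
  open Subdivision G e t
  open Equivalence
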